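{- Let $n$ be a positive even integer, and let $A\in\mathbb{C}$ with $A(A^2+4)\ne0$. Then $$A^2\det[u_{j+k}(A,-1)+\delta_{jk}]_{1\le j,k\le n}=(A-1)\big(A+u_n(A,-1)^2\big)+A\,u_{n+1}(A,-1)^2$$ and $$A^2\det[v_{j+k}(A,-1)+\delta_{jk}]_{1\le j,k\le n}=v_{n+1}(A,-1)^2.$$ In particular, $$\det[F_{j+k}+\delta_{jk}]_{1\le j,k\le n}=F_{n+1}^2\quad\text{and}\quad \det[L_{j+k}+\delta_{jk}]_{1\le j,k\le n}=L_{n+1}^2.$$ Here $\delta_{jk}$ is $1$ if $j=k$ and $0$ otherwise.
   Context: For $a,b\in\mathbb{C}$, the Lucas sequences are defined by $u_0(a,b)=0$, $u_1(a,b)=1$, $v_0(a,b)=2$, $v_1(a,b)=a$, and $u_{m+1}(a,b)=au_m(a,b)-bu_{m-1}(a,b)$, $v_{m+1}(a,b)=av_m(a,b)-bv_{m-1}(a,b)$ for $m\ge1$. The Fibonacci numbers are $F_m=u_m(1,-1)$ and the Lucas numbers are $L_m=v_m(1,-1)$. -}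

module Defs where

open import Level using (Level)
open import Algebra.Bundles using (CommutativeRing)
open import Data.Nat using (ℕ; zero; suc)
open import Data.Fin as F using (Fin; punchIn; toℕ; _≟_)
open import Relation.Nullary using (does)
open import Data.Bool using (if_then_else_)
open import Data.Integer using (ℤ)
open import Data.Integer.Properties using (+-*-commutativeRing)

module _ {c ℓ : Level} (R : CommutativeRing c ℓ) where
  open CommutativeRing R

  lucasU : Carrier → Carrier → ℕ → Carrier
  lucasU a b zero = 0#
  lucasU a b (suc zero) = 1#
  lucasU a b (suc (suc m)) = a * lucasU a b (suc m) - b * lucasU a b m

  lucasV : Carrier → Carrier → ℕ → Carrier
  lucasV a b zero = 1# + 1#
  lucasV a b (suc zero) = a
  lucasV a b (suc (suc m)) = a * lucasV a b (suc m) - b * lucasV a b m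

  det : (n : ℕ) → (Fin n → Fin n → Carrier) → Carrier
  det zero M = 1#
  det (suc n) M = cofSum (suc n) (λ j → j) 1#
    where
    -- cofSum m f sg = Σ_{i<m} sg·(-1)^i · M 0 (f i) · det(minor (f i))
    cofSum : (m : ℕ) → (Fin m → Fin (suc n)) → Carrier → Carrier
    cofSum zero f sg = 0#
    cofSum (suc m) f sg =
      sg * M F.zero (f F.zero) * det n (λ r col → M (F.suc r) (punchIn (f F.zero) col))
      + cofSum m (λ i → f (F.suc i)) (- sg)

  δ : {n : ℕ} → Fin n → Fin n → Carrier
  δ j k = if does (j ≟ k) then 1# else 0#

  four : Carrier
  four = 1# + 1# + 1# + 1#

  -- The matrix [w_{j+k} + δ_{jk}]_{1≤j,k≤n}; indices j,k : Fin n stand for j+1, k+1.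
  hankelPlusI : (n : ℕ) → (ℕ → Carrier) → Fin n → Fin n → Carrier
  hankelPlusI n w j k = w (suc (toℕ j) Data.Nat.+ suc (toℕ k)) + δ j k

module Zr = CommutativeRing +-*-commutativeRing

fib : ℕ → ℤ
fib = lucasU +-*-commutativeRing Zr.1# (Zr.- Zr.1#)

luc : ℕ → ℤ
luc = lucasV +-*-commutativeRing Zr.1# (Zr.- Zr.1#)

-- For w with w(m+2) = A w(m+1) + w(m), the addition formula w(j+k) = u(j) w(k+1) + u(j-1) w(k)
-- writes the Hankel matrix [w(j+k)] as p qᵀ + s tᵀ, so the matrix determinant lemma gives
-- det(I + p qᵀ + s tᵀ) = (1 + q·p)(1 + t·s) - (q·s)(t·p). Each of the four inner products is a
-- sum of products of two solutions of the recurrence, and A times such a sum telescopes over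
-- pairs of consecutive terms when n is even; what remains is a polynomial identity in A, u(n)
-- and u(n-1). For the determinant (Laplace expansion along the first row) everything rests on
-- its vanishing for two equal rows: for the first two rows the terms of the double expansion
-- cancel in pairs, and polarisation in the minors moves the second copy next to the first.
module Submission where

open import Defs
open import Level using (Level)
open import Algebra.Bundles using (CommutativeRing)
open import Data.Nat using (ℕ; zero; suc; _≤_)
open import Data.Nat.Divisibility using (_∣_; divides)
open import Data.Integer.Properties using (+-*-commutativeRing)
open import Data.Product using (_×_; _,_)
open import Relation.Nullary using (¬_)
open import Relation.Binary.PropositionalEquality using (_≡_)
import Data.Nat as ℕ
import Data.Nat.Properties as ℕ
open import Data.Fin using (Fin; zero; suc; punchIn; toℕ)
open import Data.Vec.Functional using (Vector; head; tail; updateAt; _∷_)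
open import Data.Vec.Functional.Properties using (updateAt-updates; updateAt-id-local; updateAt-commutes)
open import Function using (_∘_; _∋_)
import Relation.Binary.PropositionalEquality as ≡

updateAt-map : ∀ {a b} {A : Set a} {B : Set b} {n} (g : A → B) (xs : Vector A n) k v r →
  g (updateAt xs k (λ _ → v) r) ≡.≡ updateAt (g ∘ xs) k (λ _ → g v) r
updateAt-map g xs zero    v zero    = ≡.refl
updateAt-map g xs zero    v (suc r) = ≡.refl
updateAt-map g xs (suc k) v zero    = ≡.refl
updateAt-map g xs (suc k) v (suc r) = updateAt-map g (tail xs) k v r

module Determinant {c ℓ : Level} (R : CommutativeRing c ℓ) where
  open CommutativeRing R hiding (zero)
  open import Relation.Binary.Reasoning.Setoid setoid
  open import Algebra.Properties.Ring ring using (-1*x≈-x; -‿distribˡ-*; x[y-z]≈xy-xz)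
  open import Algebra.Properties.AbelianGroup +-abelianGroup using (⁻¹-∙-comm; ⁻¹-anti-homo‿-; xyx⁻¹≈y)
  open import Algebra.Properties.Group +-group using (ε⁻¹≈ε)
  open import Algebra.Properties.CommutativeSemigroup +-commutativeSemigroup using (interchange)
  open import Algebra.Properties.CommutativeSemigroup *-commutativeSemigroup using (x∙yz≈y∙xz)
  open import Algebra.Properties.Semiring.Sum semiring
    using (sum; sum-cong-≋; sum-replicate-zero; *-distribˡ-sum; *-distribʳ-sum)

  Matrix : ℕ → Set c
  Matrix n = Vector (Vector Carrier n) n

  ∑-zero : ∀ {n} {f : Vector Carrier n} → (∀ i → f i ≈ 0#) → sum f ≈ 0#
  ∑-zero {n} f≈0 = trans (sum-cong-≋ f≈0) (sum-replicate-zero n)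

  altSum : ∀ {n} → Vector Carrier n → Carrier
  altSum {zero}  _ = 0#
  altSum {suc n} v = head v - altSum (tail v)

  altSum-cong : ∀ {n} {f g : Vector Carrier n} → (∀ i → f i ≈ g i) → altSum f ≈ altSum g
  altSum-cong {zero}  f≈g = refl
  altSum-cong {suc n} f≈g = +-cong (f≈g zero) (-‿cong (altSum-cong (f≈g ∘ suc)))

  altSum-zero : ∀ {n} {f : Vector Carrier n} → (∀ i → f i ≈ 0#) → altSum f ≈ 0#
  altSum-zero {zero}  f≈0 = refl
  altSum-zero {suc n} f≈0 = trans (+-cong (f≈0 zero) (trans (-‿cong (altSum-zero (f≈0 ∘ suc))) ε⁻¹≈ε)) (+-identityʳ 0#)

  altSum-+ : ∀ {n} (f g : Vector Carrier n) → altSum (λ i → f i + g i) ≈ altSum f + altSum g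
  altSum-+ {zero}  f g = sym (+-identityʳ 0#)
  altSum-+ {suc n} f g = begin
    (f zero + g zero) - altSum (λ i → f (suc i) + g (suc i)) ≈⟨ +-congˡ (-‿cong (altSum-+ (tail f) (tail g))) ⟩
    (f zero + g zero) - (altSum (tail f) + altSum (tail g))  ≈⟨ +-congˡ (⁻¹-∙-comm _ _) ⟨
    (f zero + g zero) + (- altSum (tail f) - altSum (tail g)) ≈⟨ interchange _ _ _ _ ⟩
    altSum f + altSum g                                       ∎

  altSum-*ˡ : ∀ {n} x (f : Vector Carrier n) → altSum (λ i → x * f i) ≈ x * altSum f
  altSum-*ˡ {zero}  x f = sym (zeroʳ x)
  altSum-*ˡ {suc n} x f = trans (+-congˡ (-‿cong (altSum-*ˡ x (tail f)))) (sym (x[y-z]≈xy-xz x _ _))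

  altSum-linear : ∀ {n} (f g : Vector Carrier n) x → altSum (λ i → f i + x * g i) ≈ altSum f + x * altSum g
  altSum-linear f g x = trans (altSum-+ f (λ i → x * g i)) (+-congˡ (altSum-*ˡ x g))

  altSum-sub : ∀ {n} (f g : Vector Carrier n) → altSum (λ i → f i - g i) ≈ altSum f - altSum g
  altSum-sub f g = begin
    altSum (λ i → f i - g i)       ≈⟨ altSum-cong (λ i → +-congˡ (-1*x≈-x (g i))) ⟨
    altSum (λ i → f i + - 1# * g i) ≈⟨ altSum-linear f g (- 1#) ⟩
    altSum f + - 1# * altSum g      ≈⟨ +-congˡ (-1*x≈-x _) ⟩
    altSum f - altSum g             ∎

  altSum-∑ : ∀ {n m} (f : Vector Carrier n) (a : Vector Carrier m) (g : Fin m → Vector Carrier n) →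
    altSum (λ j → f j + sum (λ k → a k * g k j)) ≈ altSum f + sum (λ k → a k * altSum (g k))
  altSum-∑ {m = zero}  f a g = trans (altSum-cong (λ j → +-identityʳ (f j))) (sym (+-identityʳ _))
  altSum-∑ {m = suc m} f a g = begin
    altSum (λ j → f j + (a zero * g zero j + sum (λ k → a (suc k) * g (suc k) j)))
      ≈⟨ altSum-cong (λ j → +-assoc (f j) (a zero * g zero j) _) ⟨
    altSum (λ j → (f j + a zero * g zero j) + sum (λ k → a (suc k) * g (suc k) j))
      ≈⟨ altSum-∑ (λ j → f j + a zero * g zero j) (tail a) (g ∘ suc) ⟩
    altSum (λ j → f j + a zero * g zero j) + sum (λ k → a (suc k) * altSum (g (suc k)))
      ≈⟨ +-congʳ (altSum-linear f (g zero) (a zero)) ⟩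
    (altSum f + a zero * altSum (g zero)) + sum (λ k → a (suc k) * altSum (g (suc k)))
      ≈⟨ +-assoc _ _ _ ⟩
    altSum f + sum (λ k → a k * altSum (g k)) ∎

  minor : ∀ {n} → Matrix (suc n) → Fin (suc n) → Matrix n
  minor M j r c = M (suc r) (punchIn j c)

  -- `det` sums its cofactors with a where-bound function that cannot be named; once the `with`
  -- turns its arguments into variables, unification solves `laplaceSum` as that function.
  mutual
    laplaceSum : (n : ℕ) → Matrix (suc n) → (m : ℕ) → (Fin m → Fin (suc n)) → Carrier → Carrier
    laplaceSum = _

    private
      laplaceSum-solve : ∀ n (M : Matrix (suc (suc n))) → det R (suc (suc n)) M ≡.≡ det R (suc (suc n)) M
      laplaceSum-solve n M
        with 1# * M zero zero * det R (suc n) (minor M zero)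
           | - 1# * M zero (suc zero) * det R (suc n) (minor M (suc zero))
           | ((Fin n → Fin (suc (suc n))) ∋ λ i → suc (suc i)) | - (- 1#)
      ... | d₀ | d₁ | f | sg with suc n
      ... | n′ = ≡.cong (λ t → d₀ + (d₁ + t)) (≡.refl {x = laplaceSum n′ M n f sg})

  laplaceSum-altSum : ∀ n (M : Matrix (suc n)) m f sg →
    laplaceSum n M m f sg ≈ sg * altSum (λ i → M zero (f i) * det R n (minor M (f i)))
  laplaceSum-altSum n M zero    f sg = sym (zeroʳ sg)
  laplaceSum-altSum n M (suc m) f sg = begin
    sg * a * d + laplaceSum n M m (f ∘ suc) (- sg) ≈⟨ +-cong (*-assoc sg a d) (laplaceSum-altSum n M m (f ∘ suc) (- sg)) ⟩
    sg * (a * d) + - sg * S                        ≈⟨ +-congˡ (-‿distribˡ-* sg S) ⟨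
    sg * (a * d) - sg * S                          ≈⟨ x[y-z]≈xy-xz sg (a * d) S ⟨
    sg * (a * d - S)                               ∎
    where
    a = M zero (f zero)
    d = det R n (minor M (f zero))
    S = altSum (λ i → M zero (f (suc i)) * det R n (minor M (f (suc i))))

  det-expand : ∀ n (M : Matrix (suc n)) → det R (suc n) M ≈ altSum (λ j → M zero j * det R n (minor M j))
  det-expand n M = trans (laplaceSum-altSum n M (suc n) (λ j → j) 1#) (*-identityˡ _)

  det-cong : ∀ n {M N : Matrix n} → (∀ r c → M r c ≈ N r c) → det R n M ≈ det R n N
  det-cong zero    M≈N = refl
  det-cong (suc n) {M} {N} M≈N = begin
    det R (suc n) M                               ≈⟨ det-expand n M ⟩
    altSum (λ j → M zero j * det R n (minor M j)) ≈⟨ altSum-cong (λ j → *-cong (M≈N zero j) (det-cong n (λ r c → M≈N (suc r) (punchIn j c)))) ⟩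
    altSum (λ j → N zero j * det R n (minor N j)) ≈⟨ det-expand n N ⟨
    det R (suc n) N                               ∎

  infixl 6 _[_]≔_
  _[_]≔_ : ∀ {n} → Matrix n → Fin n → Vector Carrier n → Matrix n
  M [ k ]≔ v = updateAt M k (λ _ → v)

  replace-self : ∀ {n} (M : Matrix n) k r c → (M [ k ]≔ M k) r c ≡.≡ M r c
  replace-self M k r c = ≡.cong-app (updateAt-id-local k M ≡.refl r) c

  replace-same : ∀ {n} (M : Matrix n) k v c → (M [ k ]≔ v) k c ≡.≡ v c
  replace-same M k v c = ≡.cong-app (updateAt-updates k M) c

  det-minor-replace : ∀ n (M : Matrix (suc n)) (k : Fin n) v j →
    det R n (minor (M [ suc k ]≔ v) j) ≈ det R n (minor M j [ k ]≔ (v ∘ punchIn j))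
  det-minor-replace n M k v j =
    det-cong n (λ r c → reflexive (≡.cong-app (updateAt-map (_∘ punchIn j) (tail M) k v r) c))

  det-expand-replace : ∀ n (M : Matrix (suc n)) (k : Fin n) v →
    det R (suc n) (M [ suc k ]≔ v) ≈ altSum (λ j → M zero j * det R n (minor M j [ k ]≔ (v ∘ punchIn j)))
  det-expand-replace n M k v =
    trans (det-expand n (M [ suc k ]≔ v)) (altSum-cong (λ j → *-congˡ {M zero j} (det-minor-replace n M k v j)))

  det-firstRow-linear : ∀ n (M : Matrix (suc n)) (a b : Vector Carrier (suc n)) x →
    det R (suc n) (M [ zero ]≔ (λ c → a c + x * b c)) ≈ det R (suc n) (M [ zero ]≔ a) + x * det R (suc n) (M [ zero ]≔ b)
  det-firstRow-linear n M a b x = begin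
    det R (suc n) (M [ zero ]≔ (λ c → a c + x * b c)) ≈⟨ det-expand n _ ⟩
    altSum (λ j → (a j + x * b j) * d j)             ≈⟨ altSum-cong (λ j → trans (distribʳ (d j) (a j) (x * b j)) (+-congˡ (*-assoc x (b j) (d j)))) ⟩
    altSum (λ j → a j * d j + x * (b j * d j))       ≈⟨ altSum-linear (λ j → a j * d j) (λ j → b j * d j) x ⟩
    altSum (λ j → a j * d j) + x * altSum (λ j → b j * d j) ≈⟨ +-cong (det-expand n _) (*-congˡ (det-expand n _)) ⟨
    det R (suc n) (M [ zero ]≔ a) + x * det R (suc n) (M [ zero ]≔ b) ∎
    where
    d : Fin (suc n) → Carrier
    d j = det R n (minor M j)

  det-row-+ : ∀ n (M : Matrix n) k (a b : Vector Carrier n) →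
    det R n (M [ k ]≔ (λ c → a c + b c)) ≈ det R n (M [ k ]≔ a) + det R n (M [ k ]≔ b)
  det-row-+ (suc n) M zero a b = begin
    det R (suc n) (M [ zero ]≔ (λ c → a c + b c)) ≈⟨ det-expand n _ ⟩
    altSum (λ j → (a j + b j) * d j)             ≈⟨ altSum-cong (λ j → distribʳ (d j) (a j) (b j)) ⟩
    altSum (λ j → a j * d j + b j * d j)         ≈⟨ altSum-+ (λ j → a j * d j) (λ j → b j * d j) ⟩
    altSum (λ j → a j * d j) + altSum (λ j → b j * d j) ≈⟨ +-cong (det-expand n _) (det-expand n _) ⟨
    det R (suc n) (M [ zero ]≔ a) + det R (suc n) (M [ zero ]≔ b) ∎
    where
    d : Fin (suc n) → Carrier
    d j = det R n (minor M j)
  det-row-+ (suc n) M (suc k) a b = begin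
    det R (suc n) (M [ suc k ]≔ (λ c → a c + b c))          ≈⟨ det-expand-replace n M k _ ⟩
    altSum (λ j → M zero j * det R n (minor M j [ k ]≔ (λ c → a (punchIn j c) + b (punchIn j c))))
      ≈⟨ altSum-cong (λ j → trans (*-congˡ (det-row-+ n (minor M j) k (a ∘ punchIn j) (b ∘ punchIn j))) (distribˡ (M zero j) (Da j) (Db j))) ⟩
    altSum (λ j → M zero j * Da j + M zero j * Db j)         ≈⟨ altSum-+ (λ j → M zero j * Da j) (λ j → M zero j * Db j) ⟩
    altSum (λ j → M zero j * Da j) + altSum (λ j → M zero j * Db j) ≈⟨ +-cong (det-expand-replace n M k a) (det-expand-replace n M k b) ⟨
    det R (suc n) (M [ suc k ]≔ a) + det R (suc n) (M [ suc k ]≔ b) ∎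
    where
    Da Db : Fin (suc n) → Carrier
    Da j = det R n (minor M j [ k ]≔ (a ∘ punchIn j))
    Db j = det R n (minor M j [ k ]≔ (b ∘ punchIn j))

  det-firstRow-scale : ∀ n (M : Matrix (suc n)) x (v : Vector Carrier (suc n)) →
    det R (suc n) (M [ zero ]≔ (λ c → x * v c)) ≈ x * det R (suc n) (M [ zero ]≔ v)
  det-firstRow-scale n M x v = begin
    det R (suc n) (M [ zero ]≔ (λ c → x * v c)) ≈⟨ det-expand n _ ⟩
    altSum (λ j → x * v j * det R n (minor M j)) ≈⟨ altSum-cong (λ j → *-assoc x (v j) (det R n (minor M j))) ⟩
    altSum (λ j → x * (v j * det R n (minor M j))) ≈⟨ altSum-*ˡ x (λ j → v j * det R n (minor M j)) ⟩
    x * altSum (λ j → v j * det R n (minor M j)) ≈⟨ *-congˡ (det-expand n (M [ zero ]≔ v)) ⟨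
    x * det R (suc n) (M [ zero ]≔ v) ∎

  -- With Φ h the determinant of some fixed rows restricted to the columns h, cofactorExpansion g Φ
  -- is the determinant of those rows below the row x, restricted to the columns g.
  module _ {K : ℕ} (x : Vector Carrier K) where
    cofactorExpansion : ∀ {m} → (Fin (suc m) → Fin K) → ((Fin m → Fin K) → Carrier) → Carrier
    cofactorExpansion g Φ = altSum (λ k → x (g k) * Φ (g ∘ punchIn k))

    Extensional : ∀ {m} → ((Fin m → Fin K) → Carrier) → Set ℓ
    Extensional Φ = ∀ {h h′} → (∀ i → h i ≡.≡ h′ i) → Φ h ≈ Φ h′

    private
      x-y-x≈y : ∀ a b → a - (a - b) ≈ b
      x-y-x≈y a b = trans (+-congˡ (⁻¹-anti-homo‿- a b)) (trans (sym (+-assoc a b (- a))) (xyx⁻¹≈y a b))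

    -- The terms of the first column f zero in the outer and in the inner expansions cancel.
    cofactorExpansion-twice-peel : ∀ m (f : Fin (suc (suc m)) → Fin K) Φ →
      cofactorExpansion f (λ h → cofactorExpansion h Φ) ≈
      altSum (λ i → x (f (suc i)) * altSum (λ k → x (f (suc (punchIn i k))) * Φ (f ∘ punchIn (suc i) ∘ punchIn (suc k))))
    cofactorExpansion-twice-peel m f Φ = begin
      a * T - altSum (λ i → x (g i) * (a * Φ (g ∘ punchIn i) - r i))
        ≈⟨ +-congˡ (-‿cong (altSum-cong (λ i → distribute i))) ⟩
      a * T - altSum (λ i → a * (x (g i) * Φ (g ∘ punchIn i)) - x (g i) * r i)
        ≈⟨ +-congˡ (-‿cong (trans (altSum-sub (λ i → a * P i) (λ i → x (g i) * r i)) (+-congʳ (altSum-*ˡ a P)))) ⟩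
      a * T - (a * T - altSum (λ i → x (g i) * r i)) ≈⟨ x-y-x≈y _ _ ⟩
      altSum (λ i → x (g i) * r i) ∎
      where
      a = x (f zero)
      g = f ∘ suc
      P : Fin (suc m) → Carrier
      P i = x (g i) * Φ (g ∘ punchIn i)
      T = cofactorExpansion g Φ
      r : Fin (suc m) → Carrier
      r i = altSum (λ k → x (g (punchIn i k)) * Φ (f ∘ punchIn (suc i) ∘ punchIn (suc k)))
      distribute : ∀ i → x (g i) * (a * Φ (g ∘ punchIn i) - r i) ≈ a * (x (g i) * Φ (g ∘ punchIn i)) - x (g i) * r i
      distribute i = trans (x[y-z]≈xy-xz (x (g i)) _ (r i)) (+-congʳ (x∙yz≈y∙xz (x (g i)) a _))

    cofactorExpansion-twice≈0 : ∀ m (f : Fin (suc (suc m)) → Fin K) Φ → Extensional Φ →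
      cofactorExpansion f (λ h → cofactorExpansion h Φ) ≈ 0#
    cofactorExpansion-twice≈0 zero f Φ Φ-ext =
      trans (cofactorExpansion-twice-peel zero f Φ) (altSum-zero (λ i → zeroʳ (x (f (suc i)))))
    cofactorExpansion-twice≈0 (suc m) f Φ Φ-ext = begin
      cofactorExpansion f (λ h → cofactorExpansion h Φ) ≈⟨ cofactorExpansion-twice-peel (suc m) f Φ ⟩
      _ ≈⟨ altSum-cong (λ i → *-congˡ {x (f (suc i))} (altSum-cong (λ k → *-congˡ {x (f (suc (punchIn i k)))} (Φ-ext (prepend i k))))) ⟩
      cofactorExpansion (f ∘ suc) (λ h → cofactorExpansion h Φ′) ≈⟨ cofactorExpansion-twice≈0 m (f ∘ suc) Φ′ (Φ-ext ∘ cons-cong) ⟩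
      0# ∎
      where
      Φ′ : (Fin m → Fin K) → Carrier
      Φ′ h = Φ (f zero ∷ h)
      cons-cong : ∀ {h h′ : Fin m → Fin K} → (∀ i → h i ≡.≡ h′ i) → ∀ i → (f zero ∷ h) i ≡.≡ (f zero ∷ h′) i
      cons-cong h≗h′ zero    = ≡.refl
      cons-cong h≗h′ (suc i) = h≗h′ i
      prepend : ∀ i k c → f (punchIn (suc i) (punchIn (suc k) c)) ≡.≡ (f zero ∷ (f ∘ suc ∘ punchIn i ∘ punchIn k)) c
      prepend i k zero    = ≡.refl
      prepend i k (suc c) = ≡.refl

  det-first-two-rows-equal : ∀ n (M : Matrix (suc (suc n))) → (∀ c → M zero c ≈ M (suc zero) c) → det R (suc (suc n)) M ≈ 0#
  det-first-two-rows-equal n M row₀≈row₁ = begin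
    det R (suc (suc n)) M                               ≈⟨ det-expand (suc n) M ⟩
    altSum (λ j → M zero j * det R (suc n) (minor M j)) ≈⟨ altSum-cong (λ j → *-congˡ {M zero j} (expand-minor j)) ⟩
    cofactorExpansion (M zero) (λ j → j) (λ h → cofactorExpansion (M zero) h Φ)
      ≈⟨ cofactorExpansion-twice≈0 (M zero) n (λ j → j) Φ Φ-ext ⟩
    0#                                                  ∎
    where
    Φ : (Fin n → Fin (suc (suc n))) → Carrier
    Φ h = det R n (λ r c → M (suc (suc r)) (h c))
    Φ-ext : Extensional (M zero) Φ
    Φ-ext h≗h′ = det-cong n (λ r c → reflexive (≡.cong (M (suc (suc r))) (h≗h′ c)))
    expand-minor : ∀ j → det R (suc n) (minor M j) ≈ cofactorExpansion (M zero) (punchIn j) Φ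
    expand-minor j = trans (det-expand n (minor M j))
      (altSum-cong (λ k → *-congʳ {det R n (minor (minor M j) k)} (sym (row₀≈row₁ (punchIn j k)))))

  -- Rows 1 and k+2 carry an alternating bilinear form (by induction, through the minors), hence an
  -- antisymmetric one; antisymmetry moves the copy of row 0 next to it.
  det-rows-equal : ∀ n (M : Matrix (suc n)) k → (∀ c → M zero c ≈ M (suc k) c) → det R (suc n) M ≈ 0#
  det-rows-equal (suc n)       M zero    row₀≈rowₖ = det-first-two-rows-equal n M row₀≈rowₖ
  det-rows-equal (suc (suc n)) M (suc k) row₀≈rowₖ = begin
    det R (suc (suc (suc n))) M ≈⟨ det-cong _ (λ r c → reflexive (≡.sym (replace-rows-self r c))) ⟩
    D b e                       ≈⟨ +-identityʳ _ ⟨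
    D b e + 0#                  ≈⟨ +-cong (+-identityˡ _) (+-identityʳ 0#) ⟨
    (0# + D b e) + (0# + 0#)    ≈⟨ +-cong (+-congʳ (D-diagonal b)) (+-cong D-swapped (D-diagonal e)) ⟨
    (D b b + D b e) + (D e b + D e e) ≈⟨ +-cong (D-+ʳ b b e) (D-+ʳ e b e) ⟨
    D b (b +ᵥ e) + D e (b +ᵥ e)   ≈⟨ D-+ˡ b e (b +ᵥ e) ⟨
    D (b +ᵥ e) (b +ᵥ e)           ≈⟨ D-diagonal (b +ᵥ e) ⟩
    0#                          ∎
    where
    N = suc (suc (suc n))
    i₁ iₖ : Fin N
    i₁ = suc zero
    iₖ = suc (suc k)
    b e : Vector Carrier N
    b = M i₁
    e = M iₖ
    _+ᵥ_ : Vector Carrier N → Vector Carrier N → Vector Carrier N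
    (y +ᵥ z) c = y c + z c
    D : Vector Carrier N → Vector Carrier N → Carrier
    D y z = det R N (M [ i₁ ]≔ y [ iₖ ]≔ z)
    D-diagonal : ∀ y → D y y ≈ 0#
    D-diagonal y = trans (det-expand (suc (suc n)) Y) (altSum-zero (λ j → trans (*-congˡ {Y zero j} (minor-vanishes j)) (zeroʳ (Y zero j))))
      where
      Y = M [ i₁ ]≔ y [ iₖ ]≔ y
      minor-vanishes : ∀ j → det R (suc (suc n)) (minor Y j) ≈ 0#
      minor-vanishes j = det-rows-equal (suc n) (minor Y j) k (λ c → reflexive (≡.sym (replace-same (M [ i₁ ]≔ y) iₖ y (punchIn j c))))
    D-+ʳ : ∀ y z z′ → D y (z +ᵥ z′) ≈ D y z + D y z′
    D-+ʳ y = det-row-+ N (M [ i₁ ]≔ y) iₖ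
    commute : ∀ y z r c → (M [ i₁ ]≔ y [ iₖ ]≔ z) r c ≡.≡ (M [ iₖ ]≔ z [ i₁ ]≔ y) r c
    commute y z r c = ≡.cong-app (updateAt-commutes iₖ i₁ (λ ()) M r) c
    D-+ˡ : ∀ y y′ z → D (y +ᵥ y′) z ≈ D y z + D y′ z
    D-+ˡ y y′ z = begin
      D (y +ᵥ y′) z ≈⟨ det-cong N (λ r c → reflexive (commute (y +ᵥ y′) z r c)) ⟩
      det R N (M [ iₖ ]≔ z [ i₁ ]≔ (y +ᵥ y′)) ≈⟨ det-row-+ N (M [ iₖ ]≔ z) i₁ y y′ ⟩
      det R N (M [ iₖ ]≔ z [ i₁ ]≔ y) + det R N (M [ iₖ ]≔ z [ i₁ ]≔ y′)
        ≈⟨ +-cong (det-cong N (λ r c → reflexive (commute y z r c))) (det-cong N (λ r c → reflexive (commute y′ z r c))) ⟨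
      D y z + D y′ z ∎
    D-swapped : D e b ≈ 0#
    D-swapped = det-first-two-rows-equal (suc n) (M [ i₁ ]≔ e [ iₖ ]≔ b) row₀≈rowₖ
    replace-rows-self : ∀ r c → (M [ i₁ ]≔ b [ iₖ ]≔ e) r c ≡.≡ M r c
    replace-rows-self r c = ≡.trans (replace-self (M [ i₁ ]≔ b) iₖ r c) (replace-self M i₁ r c)

  -- Expand along the first row and apply the induction hypothesis to the minors; the terms with
  -- w in both row 0 and row k+1 vanish.
  det-rankOne-update : ∀ n (M : Matrix n) (a w : Vector Carrier n) →
    det R n (λ r c → M r c + a r * w c) ≈ det R n M + sum (λ k → a k * det R n (M [ k ]≔ w))
  det-rankOne-update zero    M a w = sym (+-identityʳ 1#)
  det-rankOne-update (suc n) M a w = begin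
    det R (suc n) M′ ≈⟨ det-cong (suc n) M′≈split ⟩
    det R (suc n) (M′ [ zero ]≔ (λ c → M zero c + a zero * w c)) ≈⟨ det-firstRow-linear n M′ (M zero) w (a zero) ⟩
    det R (suc n) (M′ [ zero ]≔ M zero) + a zero * det R (suc n) (M′ [ zero ]≔ w)
      ≈⟨ +-cong (expand-firstRow (M zero)) (*-congˡ (expand-firstRow w)) ⟩
    (det R (suc n) (M [ zero ]≔ M zero) + sum (λ k → a (suc k) * det R (suc n) (M [ suc k ]≔ w [ zero ]≔ M zero)))
      + a zero * (det R (suc n) (M [ zero ]≔ w) + sum (λ k → a (suc k) * det R (suc n) (M [ suc k ]≔ w [ zero ]≔ w)))
      ≈⟨ +-cong (+-cong (det-cong (suc n) (λ r c → reflexive (replace-self M zero r c)))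
                        (sum-cong-≋ (λ k → *-congˡ (det-cong (suc n) (λ r c → reflexive (replace-self (M [ suc k ]≔ w) zero r c))))))
                (*-congˡ (+-congˡ (∑-zero (λ k → trans (*-congˡ (w-twice k)) (zeroʳ _))))) ⟩
    (det R (suc n) M + S) + a zero * (det R (suc n) (M [ zero ]≔ w) + 0#)
      ≈⟨ trans (+-congˡ (*-congˡ (+-identityʳ _))) (trans (+-assoc _ _ _) (+-congˡ (+-comm S _))) ⟩
    det R (suc n) M + sum (λ k → a k * det R (suc n) (M [ k ]≔ w)) ∎
    where
    M′ : Matrix (suc n)
    M′ r c = M r c + a r * w c
    S = sum (λ k → a (suc k) * det R (suc n) (M [ suc k ]≔ w))
    M′≈split : ∀ r c → M′ r c ≈ (M′ [ zero ]≔ (λ c → M zero c + a zero * w c)) r c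
    M′≈split zero    c = refl
    M′≈split (suc r) c = refl
    d : Fin (suc n) → Carrier
    d j = det R n (minor M j)
    E : Fin n → Fin (suc n) → Carrier
    E k j = det R n (minor M j [ k ]≔ (w ∘ punchIn j))
    distribute : ∀ v j → v j * (d j + sum (λ k → a (suc k) * E k j)) ≈ v j * d j + sum (λ k → a (suc k) * (v j * E k j))
    distribute v j = trans (distribˡ (v j) (d j) _)
      (+-congˡ (trans (*-distribˡ-sum (v j) (λ k → a (suc k) * E k j)) (sum-cong-≋ (λ k → x∙yz≈y∙xz (v j) (a (suc k)) (E k j)))))
    expand-replaced : ∀ v k → det R (suc n) (M [ suc k ]≔ w [ zero ]≔ v) ≈ altSum (λ j → v j * E k j)
    expand-replaced v k = trans (det-expand n _) (altSum-cong (λ j → *-congˡ {v j} (det-minor-replace n M k w j)))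
    expand-firstRow : ∀ v → det R (suc n) (M′ [ zero ]≔ v) ≈
      det R (suc n) (M [ zero ]≔ v) + sum (λ k → a (suc k) * det R (suc n) (M [ suc k ]≔ w [ zero ]≔ v))
    expand-firstRow v = begin
      det R (suc n) (M′ [ zero ]≔ v) ≈⟨ det-expand n _ ⟩
      altSum (λ j → v j * det R n (minor M′ j))
        ≈⟨ altSum-cong (λ j → *-congˡ {v j} (det-rankOne-update n (minor M j) (a ∘ suc) (w ∘ punchIn j))) ⟩
      altSum (λ j → v j * (d j + sum (λ k → a (suc k) * E k j))) ≈⟨ altSum-cong (distribute v) ⟩
      altSum (λ j → v j * d j + sum (λ k → a (suc k) * (v j * E k j))) ≈⟨ altSum-∑ (λ j → v j * d j) (a ∘ suc) (λ k j → v j * E k j) ⟩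
      altSum (λ j → v j * d j) + sum (λ k → a (suc k) * altSum (λ j → v j * E k j))
        ≈⟨ +-cong (det-expand n _) (sum-cong-≋ (λ k → *-congˡ (expand-replaced v k))) ⟨
      det R (suc n) (M [ zero ]≔ v) + sum (λ k → a (suc k) * det R (suc n) (M [ suc k ]≔ w [ zero ]≔ v)) ∎
    w-twice : ∀ k → det R (suc n) (M [ suc k ]≔ w [ zero ]≔ w) ≈ 0#
    w-twice k = det-rows-equal n _ k (λ c → reflexive (≡.sym (replace-same M (suc k) w c)))

  det-add-firstRow-multiples : ∀ n (M : Matrix (suc n)) (a : Vector Carrier n) →
    det R (suc n) (λ r c → M r c + (0# ∷ a) r * M zero c) ≈ det R (suc n) M
  det-add-firstRow-multiples n M a =
    trans (det-rankOne-update (suc n) M (0# ∷ a) (M zero)) (trans (+-congˡ (∑-zero vanish)) (+-identityʳ _))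
    where
    vanish : ∀ k → (0# ∷ a) k * det R (suc n) (M [ k ]≔ M zero) ≈ 0#
    vanish zero    = zeroˡ _
    vanish (suc k) = trans (*-congˡ (det-rows-equal n _ k (λ c → reflexive (≡.sym (replace-same M (suc k) (M zero) c))))) (zeroʳ _)

  det-firstRow-add-rows : ∀ n (M : Matrix (suc n)) (z : Vector Carrier (suc n)) (a : Vector Carrier n) →
    det R (suc n) (M [ zero ]≔ (λ c → z c + sum (λ k → a k * M (suc k) c))) ≈ det R (suc n) (M [ zero ]≔ z)
  det-firstRow-add-rows n M z a = begin
    det R (suc n) (M [ zero ]≔ (λ c → z c + sum (λ k → a k * M (suc k) c))) ≈⟨ det-expand n _ ⟩
    altSum (λ j → (z j + sum (λ k → a k * M (suc k) j)) * d j)               ≈⟨ altSum-cong distribute ⟩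
    altSum (λ j → z j * d j + sum (λ k → a k * (M (suc k) j * d j)))         ≈⟨ altSum-∑ (λ j → z j * d j) a (λ k j → M (suc k) j * d j) ⟩
    altSum (λ j → z j * d j) + sum (λ k → a k * altSum (λ j → M (suc k) j * d j)) ≈⟨ +-congˡ (∑-zero (λ k → trans (*-congˡ (vanish k)) (zeroʳ (a k)))) ⟩
    altSum (λ j → z j * d j) + 0#                                            ≈⟨ +-identityʳ _ ⟩
    altSum (λ j → z j * d j)                                                 ≈⟨ det-expand n _ ⟨
    det R (suc n) (M [ zero ]≔ z)                                            ∎
    where
    d : Fin (suc n) → Carrier
    d j = det R n (minor M j)
    distribute : ∀ j → (z j + sum (λ k → a k * M (suc k) j)) * d j ≈ z j * d j + sum (λ k → a k * (M (suc k) j * d j))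
    distribute j = trans (distribʳ (d j) (z j) _)
      (+-congˡ (trans (*-distribʳ-sum (d j) (λ k → a k * M (suc k) j)) (sum-cong-≋ (λ k → *-assoc (a k) _ (d j)))))
    vanish : ∀ k → altSum (λ j → M (suc k) j * d j) ≈ 0#
    vanish k = trans (sym (det-expand n (M [ zero ]≔ M (suc k)))) (det-rows-equal n _ k (λ c → refl))

  det-firstRow-unit : ∀ n (M : Matrix (suc n)) → det R (suc n) (M [ zero ]≔ δ R zero) ≈ det R n (minor M zero)
  det-firstRow-unit n M = begin
    det R (suc n) (M [ zero ]≔ δ R zero) ≈⟨ det-expand n _ ⟩
    1# * det R n (minor M zero) - altSum (λ j → 0# * det R n (minor M (suc j)))
      ≈⟨ +-cong (*-identityˡ _) (trans (-‿cong (altSum-zero (λ j → zeroˡ (det R n (minor M (suc j)))))) ε⁻¹≈ε) ⟩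
    det R n (minor M zero) + 0# ≈⟨ +-identityʳ _ ⟩
    det R n (minor M zero) ∎

  det-identity : ∀ n → det R n (δ R) ≈ 1#
  det-identity zero    = refl
  det-identity (suc n) = begin
    det R (suc n) (δ R)                  ≈⟨ det-cong (suc n) (λ r c → reflexive (≡.sym (replace-self (δ R) zero r c))) ⟩
    det R (suc n) (δ R [ zero ]≔ δ R zero) ≈⟨ det-firstRow-unit n (δ R) ⟩
    det R n (δ R)                        ≈⟨ det-identity n ⟩
    1#                                   ∎

  ∑-δ : ∀ n (z : Vector Carrier n) c → sum (λ k → z k * δ R k c) ≈ z c
  ∑-δ (suc n) z zero    = trans (+-cong (*-identityʳ (z zero)) (∑-zero (λ k → zeroʳ (z (suc k))))) (+-identityʳ _)
  ∑-δ (suc n) z (suc c) = trans (+-cong (zeroʳ (z zero)) (∑-δ n (z ∘ suc) c)) (+-identityˡ _)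

  det-identity-firstRow : ∀ n (z : Vector Carrier (suc n)) → det R (suc n) (δ R [ zero ]≔ z) ≈ z zero
  det-identity-firstRow n z = begin
    det R (suc n) (δ R [ zero ]≔ z) ≈⟨ det-cong (suc n) (λ { zero c → sym (∑-δ (suc n) z c) ; (suc r) c → refl }) ⟩
    det R (suc n) (δ R [ zero ]≔ (λ c → z zero * δ R zero c + sum (λ k → z (suc k) * δ R (suc k) c)))
      ≈⟨ det-firstRow-add-rows n (δ R) (λ c → z zero * δ R zero c) (z ∘ suc) ⟩
    det R (suc n) (δ R [ zero ]≔ (λ c → z zero * δ R zero c)) ≈⟨ det-firstRow-scale n (δ R) (z zero) (δ R zero) ⟩
    z zero * det R (suc n) (δ R [ zero ]≔ δ R zero)         ≈⟨ *-congˡ (trans (det-firstRow-unit n (δ R)) (det-identity n)) ⟩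
    z zero * 1#                                            ≈⟨ *-identityʳ _ ⟩
    z zero                                                 ∎

module IdentityPlusLowRank {c ℓ : Level} (R : CommutativeRing c ℓ) where
  open CommutativeRing R hiding (zero)
  open Determinant R
  open import Relation.Binary.Reasoning.Setoid setoid
  open import Algebra.Properties.Semiring.Sum semiring using (sum; sum-cong-≋; ∑-distrib-+; *-distribʳ-sum)
  open import Algebra.Solver.Ring.NaturalCoefficients.Default commutativeSemiring using (solve; _:+_; _:*_; _:=_)

  infix 7 _·_
  _·_ : ∀ {n} → Vector Carrier n → Vector Carrier n → Carrier
  u · v = sum (λ i → u i * v i)

  I+[_⊗_] : ∀ {n} → Vector Carrier n → Vector Carrier n → Matrix n
  I+[ s ⊗ t ] r c = δ R r c + s r * t c

  I+[_⊗_+_⊗_] : ∀ {n} → Vector Carrier n → Vector Carrier n → Vector Carrier n → Vector Carrier n → Matrix n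
  I+[ p ⊗ q + s ⊗ t ] r c = δ R r c + (p r * q c + s r * t c)

  det-I+⊗-firstRow-self : ∀ n (s t : Vector Carrier (suc n)) → det R (suc n) (I+[ s ⊗ t ] [ zero ]≔ t) ≈ t zero
  det-I+⊗-firstRow-self n s t = begin
    det R (suc n) (I+[ s ⊗ t ] [ zero ]≔ t)                          ≈⟨ det-cong (suc n) clear-column ⟩
    det R (suc n) (λ r c → (δ R [ zero ]≔ t) r c + (0# ∷ tail s) r * t c) ≈⟨ det-add-firstRow-multiples n (δ R [ zero ]≔ t) (tail s) ⟩
    det R (suc n) (δ R [ zero ]≔ t)                                  ≈⟨ det-identity-firstRow n t ⟩
    t zero                                                           ∎
    where
    clear-column : ∀ r c → (I+[ s ⊗ t ] [ zero ]≔ t) r c ≈ (δ R [ zero ]≔ t) r c + (0# ∷ tail s) r * t c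
    clear-column zero    c = sym (trans (+-congˡ (zeroˡ (t c))) (+-identityʳ (t c)))
    clear-column (suc r) c = refl

  det-I+⊗ : ∀ n (s t : Vector Carrier n) → det R n I+[ s ⊗ t ] ≈ 1# + t · s
  det-I+⊗ zero    s t = sym (+-identityʳ 1#)
  det-I+⊗ (suc n) s t = begin
    det R (suc n) I+[ s ⊗ t ]                                         ≈⟨ det-cong (suc n) (λ { zero c → refl ; (suc r) c → refl }) ⟩
    det R (suc n) (I+[ s ⊗ t ] [ zero ]≔ (λ c → δ R zero c + s zero * t c)) ≈⟨ det-firstRow-linear n _ (δ R zero) t (s zero) ⟩
    det R (suc n) (I+[ s ⊗ t ] [ zero ]≔ δ R zero) + s zero * det R (suc n) (I+[ s ⊗ t ] [ zero ]≔ t)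
      ≈⟨ +-cong (det-firstRow-unit n _) (*-congˡ (det-I+⊗-firstRow-self n s t)) ⟩
    det R n I+[ tail s ⊗ tail t ] + s zero * t zero                  ≈⟨ +-congʳ (det-I+⊗ n (tail s) (tail t)) ⟩
    (1# + tail t · tail s) + s zero * t zero                          ≈⟨ regroup 1# (tail t · tail s) (s zero) (t zero) ⟩
    1# + t · s                                                        ∎
    where
    regroup : ∀ e x a b → (e + x) + a * b ≈ e + (b * a + x)
    regroup = solve 4 (λ e x a b → (e :+ x) :+ a :* b := e :+ (b :* a :+ x)) refl

  -- Adding D times the row t to the row z gives z₀ e₀ plus a combination of the rows below.
  det-I+⊗-firstRow : ∀ n (s t z : Vector Carrier (suc n)) →
    det R (suc n) (I+[ s ⊗ t ] [ zero ]≔ z) + (tail z · tail s) * t zero ≈ z zero * (1# + tail t · tail s)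
  det-I+⊗-firstRow n s t z = begin
    det R (suc n) (M [ zero ]≔ z) + D * t zero          ≈⟨ +-congˡ (*-congˡ (det-I+⊗-firstRow-self n s t)) ⟨
    det R (suc n) (M [ zero ]≔ z) + D * det R (suc n) (M [ zero ]≔ t) ≈⟨ det-firstRow-linear n M z t D ⟨
    det R (suc n) (M [ zero ]≔ (λ c → z c + D * t c))   ≈⟨ det-cong (suc n) (λ { zero c → combination c ; (suc r) c → refl }) ⟩
    det R (suc n) (M [ zero ]≔ (λ c → z zero * δ R zero c + sum (λ k → z (suc k) * M (suc k) c)))
      ≈⟨ det-firstRow-add-rows n M (λ c → z zero * δ R zero c) (tail z) ⟩
    det R (suc n) (M [ zero ]≔ (λ c → z zero * δ R zero c)) ≈⟨ det-firstRow-scale n M (z zero) (δ R zero) ⟩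
    z zero * det R (suc n) (M [ zero ]≔ δ R zero)        ≈⟨ *-congˡ (trans (det-firstRow-unit n M) (det-I+⊗ n (tail s) (tail t))) ⟩
    z zero * (1# + tail t · tail s)                      ∎
    where
    M = I+[ s ⊗ t ]
    D = tail z · tail s
    combination : ∀ c → z c + D * t c ≈ z zero * δ R zero c + sum (λ k → z (suc k) * M (suc k) c)
    combination c = sym (begin
      z zero * δ R zero c + sum (λ k → z (suc k) * (δ R (suc k) c + s (suc k) * t c))
        ≈⟨ +-congˡ (trans (sum-cong-≋ (λ k → distribˡ (z (suc k)) _ _)) (∑-distrib-+ (λ k → z (suc k) * δ R (suc k) c) (λ k → z (suc k) * (s (suc k) * t c)))) ⟩
      z zero * δ R zero c + (sum (λ k → z (suc k) * δ R (suc k) c) + sum (λ k → z (suc k) * (s (suc k) * t c)))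
        ≈⟨ +-assoc _ _ _ ⟨
      sum (λ k → z k * δ R k c) + sum (λ k → z (suc k) * (s (suc k) * t c))
        ≈⟨ +-cong (∑-δ (suc n) z c) (trans (sum-cong-≋ (λ k → sym (*-assoc (z (suc k)) (s (suc k)) (t c)))) (sym (*-distribʳ-sum (t c) (λ k → z (suc k) * s (suc k))))) ⟩
      z c + D * t c ∎)

  det-I+⊗+⊗-expand : ∀ n (p q s t : Vector Carrier (suc n)) →
    det R (suc n) I+[ p ⊗ q + s ⊗ t ] ≈
    (det R n I+[ tail p ⊗ tail q + tail s ⊗ tail t ] + p zero * det R (suc n) (I+[ s ⊗ t ] [ zero ]≔ q))
      + s zero * det R (suc n) (I+[ p ⊗ q ] [ zero ]≔ t)
  det-I+⊗+⊗-expand n p q s t = begin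
    det R (suc n) M ≈⟨ det-cong (suc n) split ⟩
    det R (suc n) (M [ zero ]≔ (λ c → (δ R zero c + p zero * q c) + s zero * t c))
      ≈⟨ det-firstRow-linear n M (λ c → δ R zero c + p zero * q c) t (s zero) ⟩
    det R (suc n) (M [ zero ]≔ (λ c → δ R zero c + p zero * q c)) + s zero * det R (suc n) (M [ zero ]≔ t)
      ≈⟨ +-congʳ (det-firstRow-linear n M (δ R zero) q (p zero)) ⟩
    (det R (suc n) (M [ zero ]≔ δ R zero) + p zero * det R (suc n) (M [ zero ]≔ q)) + s zero * det R (suc n) (M [ zero ]≔ t)
      ≈⟨ +-cong (+-cong (det-firstRow-unit n M)
                        (*-congˡ (trans (sym (det-cong (suc n) reduce₁)) (det-add-firstRow-multiples n _ (tail p)))))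
                (*-congˡ (trans (sym (det-cong (suc n) reduce₂)) (det-add-firstRow-multiples n _ (tail s)))) ⟩
    _ ∎
    where
    M = I+[ p ⊗ q + s ⊗ t ]
    split : ∀ r c → M r c ≈ (M [ zero ]≔ (λ c → (δ R zero c + p zero * q c) + s zero * t c)) r c
    split zero    c = sym (+-assoc _ _ _)
    split (suc r) c = refl
    reduce₁ : ∀ r c → (I+[ s ⊗ t ] [ zero ]≔ q) r c + (0# ∷ tail p) r * q c ≈ (M [ zero ]≔ q) r c
    reduce₁ zero    c = trans (+-congˡ (zeroˡ (q c))) (+-identityʳ (q c))
    reduce₁ (suc r) c = trans (+-assoc _ _ _) (+-congˡ (+-comm _ _))
    reduce₂ : ∀ r c → (I+[ p ⊗ q ] [ zero ]≔ t) r c + (0# ∷ tail s) r * t c ≈ (M [ zero ]≔ t) r c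
    reduce₂ zero    c = trans (+-congˡ (zeroˡ (t c))) (+-identityʳ (t c))
    reduce₂ (suc r) c = +-assoc _ _ _

  -- det I+[ p ⊗ q + s ⊗ t ] = (1 + q·p)(1 + t·s) - (q·s)(t·p), stated without subtraction.
  det-I+⊗+⊗ : ∀ n (p q s t : Vector Carrier n) →
    det R n I+[ p ⊗ q + s ⊗ t ] + (q · s) * (t · p) ≈ (1# + q · p) * (1# + t · s)
  det-I+⊗+⊗ zero    p q s t = trans (trans (+-congˡ (zeroˡ 0#)) (+-identityʳ 1#))
                                    (sym (trans (*-cong (+-identityʳ 1#) (+-identityʳ 1#)) (*-identityˡ 1#)))
  det-I+⊗+⊗ (suc n) p q s t = begin
    det R (suc n) I+[ p ⊗ q + s ⊗ t ] + (q · s) * (t · p)        ≈⟨ +-congʳ (det-I+⊗+⊗-expand n p q s t) ⟩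
    ((D′ + p zero * G₁) + s zero * G₂) + (q zero * s zero + c′) * (t zero * p zero + d′)
      ≈⟨ collect D′ G₁ G₂ (p zero) (q zero) (s zero) (t zero) c′ d′ ⟩
    (D′ + c′ * d′) + p zero * (G₁ + c′ * t zero) + s zero * (G₂ + d′ * q zero) + q zero * s zero * t zero * p zero
      ≈⟨ +-congʳ (+-cong (+-cong (det-I+⊗+⊗ n (tail p) (tail q) (tail s) (tail t))
                                 (*-congˡ (det-I+⊗-firstRow n s t q)))
                         (*-congˡ (det-I+⊗-firstRow n p q t))) ⟩
    (1# + a′) * (1# + b′) + p zero * (q zero * (1# + b′)) + s zero * (t zero * (1# + a′)) + q zero * s zero * t zero * p zero
      ≈⟨ factor 1# a′ b′ (p zero) (q zero) (s zero) (t zero) ⟩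
    (1# + q · p) * (1# + t · s) ∎
    where
    D′ = det R n I+[ tail p ⊗ tail q + tail s ⊗ tail t ]
    G₁ = det R (suc n) (I+[ s ⊗ t ] [ zero ]≔ q)
    G₂ = det R (suc n) (I+[ p ⊗ q ] [ zero ]≔ t)
    a′ = tail q · tail p
    b′ = tail t · tail s
    c′ = tail q · tail s
    d′ = tail t · tail p
    collect : ∀ D g₁ g₂ p₀ q₀ s₀ t₀ c d →
      ((D + p₀ * g₁) + s₀ * g₂) + (q₀ * s₀ + c) * (t₀ * p₀ + d) ≈
      (D + c * d) + p₀ * (g₁ + c * t₀) + s₀ * (g₂ + d * q₀) + q₀ * s₀ * t₀ * p₀
    collect = solve 9 (λ D g₁ g₂ p₀ q₀ s₀ t₀ c d →
      ((D :+ p₀ :* g₁) :+ s₀ :* g₂) :+ (q₀ :* s₀ :+ c) :* (t₀ :* p₀ :+ d) :=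
      (D :+ c :* d) :+ p₀ :* (g₁ :+ c :* t₀) :+ s₀ :* (g₂ :+ d :* q₀) :+ q₀ :* s₀ :* t₀ :* p₀) refl
    factor : ∀ e a b p₀ q₀ s₀ t₀ →
      (e + a) * (e + b) + p₀ * (q₀ * (e + b)) + s₀ * (t₀ * (e + a)) + q₀ * s₀ * t₀ * p₀ ≈
      (e + (q₀ * p₀ + a)) * (e + (t₀ * s₀ + b))
    factor = solve 7 (λ e a b p₀ q₀ s₀ t₀ →
      (e :+ a) :* (e :+ b) :+ p₀ :* (q₀ :* (e :+ b)) :+ s₀ :* (t₀ :* (e :+ a)) :+ q₀ :* s₀ :* t₀ :* p₀ :=
      (e :+ (q₀ :* p₀ :+ a)) :* (e :+ (t₀ :* s₀ :+ b))) refl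

module LucasHankel {c ℓ : Level} (R : CommutativeRing c ℓ) (A : CommutativeRing.Carrier R) where
  open CommutativeRing R hiding (zero)
  open Determinant R
  open IdentityPlusLowRank R
  open import Relation.Binary.Reasoning.Setoid setoid
  open import Algebra.Properties.Ring ring using (-1*x≈-x; [y-z]x≈yx-zx)
  open import Algebra.Properties.Group +-group using (⁻¹-involutive; ∙-cancelʳ; x≈z//y)
  open import Algebra.Properties.CommutativeSemigroup +-commutativeSemigroup using (xy∙z≈xz∙y)
  open import Algebra.Properties.Semiring.Sum semiring using (sum)
  open import Algebra.Solver.Ring.NaturalCoefficients.Default commutativeSemiring using (solve; _:+_; _:*_; _:=_; con)

  u v : ℕ → Carrier
  u = lucasU R A (- 1#)
  v = lucasV R A (- 1#)

  -- u₋ m = u(m-1), with u(-1) = 1 so that the recurrence still holds at the start.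
  u₋ : ℕ → Carrier
  u₋ zero    = 1#
  u₋ (suc m) = u m

  Recurrent : (ℕ → Carrier) → Set ℓ
  Recurrent w = ∀ m → w (suc (suc m)) ≈ A * w (suc m) + w m

  private
    minus-neg-one : ∀ x → - (- 1# * x) ≈ x
    minus-neg-one x = trans (-‿cong (-1*x≈-x x)) (⁻¹-involutive x)

  u-recurrent : Recurrent u
  u-recurrent m = +-congˡ (minus-neg-one (u m))

  v-recurrent : Recurrent v
  v-recurrent m = +-congˡ (minus-neg-one (v m))

  u₋-recurrent : Recurrent u₋
  u₋-recurrent zero    = sym (trans (+-congʳ (zeroʳ A)) (+-identityˡ 1#))
  u₋-recurrent (suc m) = u-recurrent m

  addition-formula : ∀ {w} → Recurrent w → ∀ a b → w (a ℕ.+ b) ≈ u a * w (suc b) + u₋ a * w b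
  addition-formula w-rec zero          b = sym (trans (+-cong (zeroˡ _) (*-identityˡ _)) (+-identityˡ _))
  addition-formula w-rec (suc zero)    b = sym (trans (+-cong (*-identityˡ _) (zeroˡ _)) (+-identityʳ _))
  addition-formula {w} w-rec (suc (suc a)) b = begin
    w (suc (suc (a ℕ.+ b)))                                        ≈⟨ w-rec (a ℕ.+ b) ⟩
    A * w (suc (a ℕ.+ b)) + w (a ℕ.+ b)                            ≈⟨ +-cong (*-congˡ (addition-formula w-rec (suc a) b)) (addition-formula w-rec a b) ⟩
    A * (u (suc a) * w₁ + u₋ (suc a) * w₀) + (u a * w₁ + u₋ a * w₀) ≈⟨ regroup A (u (suc a)) (u a) (u₋ (suc a)) (u₋ a) w₁ w₀ ⟩
    (A * u (suc a) + u a) * w₁ + (A * u₋ (suc a) + u₋ a) * w₀       ≈⟨ +-cong (*-congʳ (u-recurrent a)) (*-congʳ (u₋-recurrent a)) ⟨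
    u (suc (suc a)) * w₁ + u₋ (suc (suc a)) * w₀                    ∎
    where
    w₁ = w (suc b)
    w₀ = w b
    regroup : ∀ A x₁ x₀ y₁ y₀ w₁ w₀ → A * (x₁ * w₁ + y₁ * w₀) + (x₀ * w₁ + y₀ * w₀) ≈ (A * x₁ + x₀) * w₁ + (A * y₁ + y₀) * w₀
    regroup = solve 7 (λ A x₁ x₀ y₁ y₀ w₁ w₀ →
      A :* (x₁ :* w₁ :+ y₁ :* w₀) :+ (x₀ :* w₁ :+ y₀ :* w₀) := (A :* x₁ :+ x₀) :* w₁ :+ (A :* y₁ :+ y₀) :* w₀) refl

  crossSum : ℕ → (ℕ → Carrier) → (ℕ → Carrier) → Carrier
  crossSum n x y = sum (λ (j : Fin n) → y (suc (toℕ j)) * x (suc (toℕ j)))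

  det-hankelPlusI : ∀ {w} → Recurrent w → ∀ n →
    det R n (hankelPlusI R n w) + crossSum n u₋ (w ∘ ℕ.suc) * crossSum n u w ≈ (1# + crossSum n u (w ∘ ℕ.suc)) * (1# + crossSum n u₋ w)
  det-hankelPlusI {w} w-rec n = trans (+-congʳ (det-cong n rankTwo))
    (det-I+⊗+⊗ n (u ∘ ℕ.suc ∘ toℕ) (w ∘ ℕ.suc ∘ ℕ.suc ∘ toℕ) (u ∘ toℕ) (w ∘ ℕ.suc ∘ toℕ))
    where
    rankTwo : ∀ r c → hankelPlusI R n w r c ≈ I+[ u ∘ ℕ.suc ∘ toℕ ⊗ w ∘ ℕ.suc ∘ ℕ.suc ∘ toℕ + u ∘ toℕ ⊗ w ∘ ℕ.suc ∘ toℕ ] r c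
    rankTwo r c = trans (+-comm _ _) (+-congˡ (addition-formula w-rec (suc (toℕ r)) (suc (toℕ c))))

  -- Pairs of consecutive terms telescope; this is where the evenness of n is used.
  crossSum-telescopes : ∀ {x y} → Recurrent x → Recurrent y → ∀ k →
    A * crossSum (k ℕ.* 2) x y + y 1 * x 0 ≈ y (suc (k ℕ.* 2)) * x (k ℕ.* 2)
  crossSum-telescopes x-rec y-rec zero = trans (+-congʳ (zeroʳ A)) (+-identityˡ _)
  crossSum-telescopes {x} {y} x-rec y-rec (suc k) = begin
    A * (y 1 * x 1 + (y 2 * x 2 + S)) + y 1 * x 0                 ≈⟨ +-congʳ (*-congˡ (+-congˡ (+-congʳ (*-congˡ (x-rec 0))))) ⟩
    A * (y 1 * x 1 + (y 2 * (A * x 1 + x 0) + S)) + y 1 * x 0     ≈⟨ shift A (x 0) (x 1) (y 1) (y 2) S ⟩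
    A * S + (A * y 2 + y 1) * (A * x 1 + x 0)                     ≈⟨ +-congˡ (*-cong (y-rec 1) (x-rec 0)) ⟨
    A * S + y 3 * x 2                                             ≈⟨ crossSum-telescopes (x-rec ∘ ℕ.suc ∘ ℕ.suc) (y-rec ∘ ℕ.suc ∘ ℕ.suc) k ⟩
    y (suc (suc k ℕ.* 2)) * x (suc k ℕ.* 2)                        ∎
    where
    S = crossSum (k ℕ.* 2) (x ∘ ℕ.suc ∘ ℕ.suc) (y ∘ ℕ.suc ∘ ℕ.suc)
    shift : ∀ A x₀ x₁ y₁ y₂ S → A * (y₁ * x₁ + (y₂ * (A * x₁ + x₀) + S)) + y₁ * x₀ ≈ A * S + (A * y₂ + y₁) * (A * x₁ + x₀)
    shift = solve 6 (λ A x₀ x₁ y₁ y₂ S →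
      A :* (y₁ :* x₁ :+ (y₂ :* (A :* x₁ :+ x₀) :+ S)) :+ y₁ :* x₀ := A :* S :+ (A :* y₂ :+ y₁) :* (A :* x₁ :+ x₀)) refl

  -- The rank-two formula multiplied by A², with every A · crossSum replaced by its telescoped value.
  det-hankelPlusI-scaled : ∀ {w} → Recurrent w → ∀ k → let n = k ℕ.* 2 in
    (A * A) * det R n (hankelPlusI R n w) + (w (suc (suc n)) * u₋ n * (w (suc n) * u n) + (A + w (suc (suc n)) * u n) * w 1)
      ≈ (A + w (suc (suc n)) * u n) * (A + w (suc n) * u₋ n) + w 2 * (w (suc n) * u n)
  det-hankelPlusI-scaled {w} w-rec k = begin
    A * A * D + (W₂ * T * (W₁ * U) + (A + W₂ * U) * w 1)
      ≈⟨ +-congˡ (+-cong (*-cong h₃ h₄) (*-congʳ (+-congˡ h₁))) ⟨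
    A * A * D + ((A * X₃ + w 2 * 1#) * (A * X₄ + w 1 * 0#) + (A + (A * X₁ + w 2 * 0#)) * w 1)
      ≈⟨ expand A D X₁ X₃ X₄ (w 1) (w 2) ⟩
    A * A * (D + X₃ * X₄) + ((A + A * X₁) * w 1 + w 2 * (A * X₄))
      ≈⟨ +-congʳ (*-congˡ (det-hankelPlusI w-rec n)) ⟩
    A * A * ((1# + X₁) * (1# + X₂)) + ((A + A * X₁) * w 1 + w 2 * (A * X₄))
      ≈⟨ factor A X₁ X₂ X₄ (w 1) (w 2) ⟩
    (A + (A * X₁ + w 2 * 0#)) * (A + (A * X₂ + w 1 * 1#)) + w 2 * (A * X₄ + w 1 * 0#)
      ≈⟨ +-cong (*-cong (+-congˡ h₁) (+-congˡ h₂)) (*-congˡ h₄) ⟩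
    (A + W₂ * U) * (A + W₁ * T) + w 2 * (W₁ * U) ∎
    where
    n = k ℕ.* 2
    U = u n
    T = u₋ n
    W₁ = w (suc n)
    W₂ = w (suc (suc n))
    D = det R n (hankelPlusI R n w)
    X₁ = crossSum n u (w ∘ ℕ.suc)
    X₂ = crossSum n u₋ w
    X₃ = crossSum n u₋ (w ∘ ℕ.suc)
    X₄ = crossSum n u w
    h₁ : A * X₁ + w 2 * 0# ≈ W₂ * U
    h₁ = crossSum-telescopes u-recurrent (w-rec ∘ ℕ.suc) k
    h₂ : A * X₂ + w 1 * 1# ≈ W₁ * T
    h₂ = crossSum-telescopes u₋-recurrent w-rec k
    h₃ : A * X₃ + w 2 * 1# ≈ W₂ * T
    h₃ = crossSum-telescopes u₋-recurrent (w-rec ∘ ℕ.suc) k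
    h₄ : A * X₄ + w 1 * 0# ≈ W₁ * U
    h₄ = crossSum-telescopes u-recurrent w-rec k
    expand : ∀ A D X₁ X₃ X₄ w₁ w₂ →
      A * A * D + ((A * X₃ + w₂ * 1#) * (A * X₄ + w₁ * 0#) + (A + (A * X₁ + w₂ * 0#)) * w₁) ≈
      A * A * (D + X₃ * X₄) + ((A + A * X₁) * w₁ + w₂ * (A * X₄))
    expand = solve 7 (λ A D X₁ X₃ X₄ w₁ w₂ →
      A :* A :* D :+ ((A :* X₃ :+ w₂ :* con 1) :* (A :* X₄ :+ w₁ :* con 0) :+ (A :+ (A :* X₁ :+ w₂ :* con 0)) :* w₁) :=
      A :* A :* (D :+ X₃ :* X₄) :+ ((A :+ A :* X₁) :* w₁ :+ w₂ :* (A :* X₄))) refl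
    factor : ∀ A X₁ X₂ X₄ w₁ w₂ →
      A * A * ((1# + X₁) * (1# + X₂)) + ((A + A * X₁) * w₁ + w₂ * (A * X₄)) ≈
      (A + (A * X₁ + w₂ * 0#)) * (A + (A * X₂ + w₁ * 1#)) + w₂ * (A * X₄ + w₁ * 0#)
    factor = solve 6 (λ A X₁ X₂ X₄ w₁ w₂ →
      A :* A :* ((con 1 :+ X₁) :* (con 1 :+ X₂)) :+ ((A :+ A :* X₁) :* w₁ :+ w₂ :* (A :* X₄)) :=
      (A :+ (A :* X₁ :+ w₂ :* con 0)) :* (A :+ (A :* X₂ :+ w₁ :* con 1)) :+ w₂ :* (A :* X₄ :+ w₁ :* con 0)) refl

  det-hankelPlusI-u : ∀ k → let n = k ℕ.* 2 in
    (A * A) * det R n (hankelPlusI R n u) ≈ (A - 1#) * (A + u n * u n) + A * (u (suc n) * u (suc n))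
  det-hankelPlusI-u k = begin
    D                                            ≈⟨ x≈z//y D (A + U * U) _ (∙-cancelʳ K _ _ (begin
      (D + (A + U * U)) + K                        ≈⟨ xy∙z≈xz∙y D _ K ⟩
      (D + K) + (A + U * U)                        ≈⟨ +-congʳ (det-hankelPlusI-scaled u-recurrent k) ⟩
      ((A + W * U) * (A + V * T) + u 2 * (V * U)) + (A + U * U) ≈⟨ algebra ⟩
      (A * (A + U * U) + A * (V * V)) + K          ∎)) ⟩
    (A * (A + U * U) + A * (V * V)) - (A + U * U) ≈⟨ xy∙z≈xz∙y _ _ _ ⟩
    (A * (A + U * U) - (A + U * U)) + A * (V * V) ≈⟨ +-congʳ (trans ([y-z]x≈yx-zx _ A 1#) (+-congˡ (-‿cong (*-identityˡ _)))) ⟨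
    (A - 1#) * (A + U * U) + A * (V * V)         ∎
    where
    n = k ℕ.* 2
    U = u n
    T = u₋ n
    V = u (suc n)
    W = u (suc (suc n))
    D = (A * A) * det R n (hankelPlusI R n u)
    K = W * T * (V * U) + (A + W * U) * 1#
    V≈ : V ≈ A * U + T
    V≈ = u₋-recurrent n
    W≈ : W ≈ A * (A * U + T) + U
    W≈ = trans (u-recurrent n) (+-congʳ (*-congˡ V≈))
    polynomial : ∀ A U T → let V = A * U + T ; W = A * V + U in
      ((A + W * U) * (A + V * T) + (A * 1# + 0#) * (V * U)) + (A + U * U) ≈
      (A * (A + U * U) + A * (V * V)) + (W * T * (V * U) + (A + W * U) * 1#)
    polynomial = solve 3 (λ A U T → let V = A :* U :+ T ; W = A :* V :+ U in
      ((A :+ W :* U) :* (A :+ V :* T) :+ (A :* con 1 :+ con 0) :* (V :* U)) :+ (A :+ U :* U) :=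
      (A :* (A :+ U :* U) :+ A :* (V :* V)) :+ (W :* T :* (V :* U) :+ (A :+ W :* U) :* con 1)) refl
    algebra : ((A + W * U) * (A + V * T) + u 2 * (V * U)) + (A + U * U) ≈ (A * (A + U * U) + A * (V * V)) + K
    algebra = begin
      ((A + W * U) * (A + V * T) + u 2 * (V * U)) + (A + U * U)
        ≈⟨ +-congʳ (+-cong (*-cong (+-congˡ (*-congʳ W≈)) (+-congˡ (*-congʳ V≈))) (*-cong (u-recurrent 0) (*-congʳ V≈))) ⟩
      _ ≈⟨ polynomial A U T ⟩
      _ ≈⟨ +-cong (+-congˡ (*-congˡ (*-cong V≈ V≈)))
                  (+-cong (*-cong (*-congʳ W≈) (*-congʳ V≈)) (*-congʳ (+-congˡ (*-congʳ W≈)))) ⟨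
      (A * (A + U * U) + A * (V * V)) + K ∎

  det-hankelPlusI-v : ∀ k → let n = k ℕ.* 2 in
    (A * A) * det R n (hankelPlusI R n v) ≈ v (suc n) * v (suc n)
  det-hankelPlusI-v k = ∙-cancelʳ K _ _ (begin
    D + K                                          ≈⟨ det-hankelPlusI-scaled v-recurrent k ⟩
    (A + W₂ * U) * (A + W₁ * T) + v 2 * (W₁ * U)   ≈⟨ algebra ⟩
    W₁ * W₁ + K                                    ∎)
    where
    n = k ℕ.* 2
    U = u n
    T = u₋ n
    W₁ = v (suc n)
    W₂ = v (suc (suc n))
    D = (A * A) * det R n (hankelPlusI R n v)
    K = W₂ * T * (W₁ * U) + (A + W₂ * U) * A
    V≈ : u (suc n) ≈ A * U + T
    V≈ = u₋-recurrent n
    W≈ : u (suc (suc n)) ≈ A * (A * U + T) + U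
    W≈ = trans (u-recurrent n) (+-congʳ (*-congˡ V≈))
    v-at : ∀ m → v m ≈ u m * A + u₋ m * (1# + 1#)
    v-at m = trans (reflexive (≡.cong v (≡.sym (ℕ.+-identityʳ m)))) (addition-formula v-recurrent m 0)
    W₁≈ : W₁ ≈ (A * U + T) * A + U * (1# + 1#)
    W₁≈ = trans (v-at (suc n)) (+-congʳ (*-congʳ V≈))
    W₂≈ : W₂ ≈ (A * (A * U + T) + U) * A + (A * U + T) * (1# + 1#)
    W₂≈ = trans (v-at (suc (suc n))) (+-cong (*-congʳ W≈) (*-congʳ V≈))
    polynomial : ∀ A U T → let V = A * U + T ; W = A * V + U ; W₁ = V * A + U * (1# + 1#) ; W₂ = W * A + V * (1# + 1#) in
      (A + W₂ * U) * (A + W₁ * T) + (A * A + (1# + 1#)) * (W₁ * U) ≈ W₁ * W₁ + (W₂ * T * (W₁ * U) + (A + W₂ * U) * A)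
    polynomial = solve 3 (λ A U T → let V = A :* U :+ T ; W = A :* V :+ U ; W₁ = V :* A :+ U :* con 2 ; W₂ = W :* A :+ V :* con 2 in
      (A :+ W₂ :* U) :* (A :+ W₁ :* T) :+ (A :* A :+ con 2) :* (W₁ :* U) := W₁ :* W₁ :+ (W₂ :* T :* (W₁ :* U) :+ (A :+ W₂ :* U) :* A)) refl
    algebra : (A + W₂ * U) * (A + W₁ * T) + v 2 * (W₁ * U) ≈ W₁ * W₁ + K
    algebra = begin
      (A + W₂ * U) * (A + W₁ * T) + v 2 * (W₁ * U)
        ≈⟨ +-cong (*-cong (+-congˡ (*-congʳ W₂≈)) (+-congˡ (*-congʳ W₁≈))) (*-cong (v-recurrent 0) (*-congʳ W₁≈)) ⟩
      _ ≈⟨ polynomial A U T ⟩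
      _ ≈⟨ +-cong (*-cong W₁≈ W₁≈) (+-cong (*-cong (*-congʳ W₂≈) (*-congʳ W₁≈)) (*-congʳ (+-congˡ (*-congʳ W₂≈)))) ⟨
      W₁ * W₁ + K ∎

module UnitLucasHankel {c ℓ : Level} (R : CommutativeRing c ℓ) where
  open CommutativeRing R hiding (zero)
  open LucasHankel R 1#
  open import Relation.Binary.Reasoning.Setoid setoid

  private
    unit-scale : ∀ x → (1# * 1#) * x ≈ x
    unit-scale x = trans (*-congʳ (*-identityˡ 1#)) (*-identityˡ x)

  det-hankelPlusI-u-unit : ∀ k → let n = k ℕ.* 2 in det R n (hankelPlusI R n u) ≈ u (suc n) * u (suc n)
  det-hankelPlusI-u-unit k = begin
    det R n (hankelPlusI R n u)                          ≈⟨ unit-scale _ ⟨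
    (1# * 1#) * det R n (hankelPlusI R n u)              ≈⟨ det-hankelPlusI-u k ⟩
    (1# - 1#) * (1# + u n * u n) + 1# * (u (suc n) * u (suc n)) ≈⟨ +-cong (trans (*-congʳ (-‿inverseʳ 1#)) (zeroˡ _)) (*-identityˡ _) ⟩
    0# + u (suc n) * u (suc n)                           ≈⟨ +-identityˡ _ ⟩
    u (suc n) * u (suc n)                                ∎
    where
    n = k ℕ.* 2

  det-hankelPlusI-v-unit : ∀ k → let n = k ℕ.* 2 in det R n (hankelPlusI R n v) ≈ v (suc n) * v (suc n)
  det-hankelPlusI-v-unit k = trans (sym (unit-scale _)) (det-hankelPlusI-v k)

corollary1p16 : {c ℓ : Level} →
  ((R : CommutativeRing c ℓ) →
    let open CommutativeRing R in
    (n : ℕ) → 1 ≤ n → 2 ∣ n → (A : Carrier) → ¬ (A * (A * A + four R) ≈ 0#) →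
      ((A * A) * det R n (hankelPlusI R n (lucasU R A (- 1#)))
        ≈ (A - 1#) * (A + lucasU R A (- 1#) n * lucasU R A (- 1#) n)
          + A * (lucasU R A (- 1#) (suc n) * lucasU R A (- 1#) (suc n)))
      × ((A * A) * det R n (hankelPlusI R n (lucasV R A (- 1#)))
        ≈ lucasV R A (- 1#) (suc n) * lucasV R A (- 1#) (suc n)))
  × ((n : ℕ) → 1 ≤ n → 2 ∣ n →
      (det +-*-commutativeRing n (hankelPlusI +-*-commutativeRing n fib)
        ≡ Zr._*_ (fib (suc n)) (fib (suc n)))
      × (det +-*-commutativeRing n (hankelPlusI +-*-commutativeRing n luc)
        ≡ Zr._*_ (luc (suc n)) (luc (suc n))))
corollary1p16 =
  (λ R → λ { n _ (divides k ≡.refl) A _ → LucasHankel.det-hankelPlusI-u R A k , LucasHankel.det-hankelPlusI-v R A k }) ,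
  (λ { n _ (divides k ≡.refl) → UnitLucasHankel.det-hankelPlusI-u-unit +-*-commutativeRing k
                              , UnitLucasHankel.det-hankelPlusI-v-unit +-*-commutativeRing k })
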